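{- Let $M,I\subseteq[n]$ with $|M|=|I|$ and $n\in M\cap I$. Then for all $\pi,\sigma\in\mathfrak{S}_n(M,I)$: $\mathrm{ci}(\pi)=\mathrm{ci}(\sigma)$ if and only if $\pi=\sigma$, and $\mathrm{ca}(\pi)=\mathrm{ca}(\sigma)$ if and only if $\pi=\sigma$.
   Context: For $\pi\in\mathfrak{S}_n$, a right-to-left maximum is a position $j$ with $\pi(j)>\pi(i)$ for all $i>j$. $\mathfrak{S}_n(M,I)$ is the set of $\pi\in\mathfrak{S}_n$ whose right-to-left maxima occur exactly at the positions in $I$ and whose right-to-left maximum values form exactly the set $M$. Define, for values $x,y$ of $\pi$: $I^+(\pi)$ is the set of pairs $(y,x)$ such that $y$ appears to the left of $x$, $y>x$, and some value $z>y$ appears to the right of $x$ (the inversion plays the role of $21$ in an occurrence of $213$); $A^+(\pi)$ is the set of pairs $(x,y)$ such that $x$ appears to the left of $y$, $x<y$, and some value $z>y$ appears to the right of $y$ (the non-inversion plays the role of $12$ in an occurrence of $123$). Define functions $\mathrm{ci}(\pi),\mathrm{ca}(\pi):[n]\setminus M\to[n-1]$ by $\mathrm{ci}(\pi)(y)=|\{x:(y,x)\in I^+(\pi)\}|$ and $\mathrm{ca}(\pi)(y)=|\{x:(x,y)\in A^+(\pi)\}|$. -}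

module Defs where

open import Data.Nat using (ℕ)
open import Data.Fin using (Fin; _<_; _<?_)
open import Data.Fin.Properties using (any?)
open import Data.Fin.Permutation using (Permutation′; _⟨$⟩ʳ_; _⟨$⟩ˡ_)
open import Data.Fin.Subset using (Subset; _∈_)
open import Data.List using (List; length; filter; allFin)
open import Data.Product using (Σ; ∃; _×_)
open import Relation.Nullary using (Dec)
open import Relation.Nullary.Decidable using (_×-dec_)
open import Relation.Binary.PropositionalEquality using (_≡_)

-- Perm n : permutations of [n], with positions and values both encoded as
-- Fin n (0-based: position/value k ∈ Fin n stands for k+1 ∈ [n]).
-- π ⟨$⟩ʳ j  is the value π(j) at position j;  π ⟨$⟩ˡ v  is the position of v.
Perm : ℕ → Set
Perm n = Permutation′ n

val : ∀ {n} → Perm n → Fin n → Fin n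
val π j = π ⟨$⟩ʳ j

pos : ∀ {n} → Perm n → Fin n → Fin n
pos π v = π ⟨$⟩ˡ v

RLMax : ∀ {n} → Perm n → Fin n → Set
RLMax π j = ∀ i → j < i → val π i < val π j

record InS {n} (M I : Subset n) (π : Perm n) : Set where
  field
    positions⇒ : ∀ j → j ∈ I → RLMax π j
    positions⇐ : ∀ j → RLMax π j → j ∈ I
    values⇒    : ∀ v → v ∈ M → Σ (Fin n) λ j → RLMax π j × val π j ≡ v
    values⇐    : ∀ j → RLMax π j → val π j ∈ M

count : ∀ {n} {P : Fin n → Set} → (∀ x → Dec (P x)) → ℕ
count {n} P? = length (filter P? (allFin n))

IPlus : ∀ {n} → Perm n → Fin n → Fin n → Set
IPlus π y x = (pos π y < pos π x) × (x < y) × ∃ λ z → (y < z) × (pos π x < pos π z)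

APlus : ∀ {n} → Perm n → Fin n → Fin n → Set
APlus π x y = (pos π x < pos π y) × (x < y) × ∃ λ z → (y < z) × (pos π y < pos π z)

IPlus? : ∀ {n} (π : Perm n) y x → Dec (IPlus π y x)
IPlus? π y x = (pos π y <? pos π x) ×-dec ((x <? y) ×-dec
  any? (λ z → (y <? z) ×-dec (pos π x <? pos π z)))

APlus? : ∀ {n} (π : Perm n) x y → Dec (APlus π x y)
APlus? π x y = (pos π x <? pos π y) ×-dec ((x <? y) ×-dec
  any? (λ z → (y <? z) ×-dec (pos π y <? pos π z)))

ci : ∀ {n} → Perm n → Fin n → ℕ
ci π y = count (IPlus? π y)

ca : ∀ {n} → Perm n → Fin n → ℕ
ca π y = count (λ x → APlus? π x y)

module Submission where

-- Two permutations of S_n(M,I) are compared value by value, from n downwards: assume every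
-- value above y sits at the same position in π and in σ, and say y sits further left in π.
-- If y ∈ M, then its position in π is in I, so it is a right-to-left maximum of σ as well,
-- carrying a value above y; that value then sits there in π too, which is absurd.
-- If y ∉ M, some larger value lies to the right of y, and moving y left while keeping the
-- larger values fixed strictly increases ci(y) and strictly decreases ca(y): the positions
-- holding a counted x in σ also hold one in π (resp. conversely), and the position of y in σ
-- (resp. π) is counted only in π (resp. σ).

open import Defs
open import Data.Nat using (ℕ; suc; zero; _≤_; z≤n) renaming (_<_ to _<ℕ_)
import Data.Nat.Properties as ℕ
open import Data.Fin using (Fin; fromℕ; _<_; _<?_)
open import Data.Fin.Properties using (<-cmp; <-irrefl; <-trans; <-asym; <⇒≢; any?)
open import Data.Fin.Induction using (>-wellFounded)
open import Data.Fin.Subset using (Subset; _∈_; _∉_; ∣_∣)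
open import Data.Fin.Subset.Properties using (_∈?_)
open import Data.Fin.Permutation using (_⟨$⟩ʳ_; inverseˡ; inverseʳ; flip)
open import Data.Product using (_×_; _,_; ∃)
open import Data.List using (length; filter; tabulate)
open import Data.Empty using (⊥-elim)
open import Function.Base using (_∘_)
open import Function.Bundles using (_⇔_; mk⇔)
open import Induction.WellFounded using (module All)
open import Level using (0ℓ)
open import Relation.Nullary using (Dec; yes; no; ¬_; _×-dec_)
open import Relation.Binary.Definitions using (tri<; tri≈; tri>)
open import Relation.Binary.PropositionalEquality
  using (_≡_; _≢_; refl; sym; trans; cong; subst; subst₂; module ≡-Reasoning)
open import Algebra.Properties.CommutativeMonoid.Sum ℕ.+-0-commutativeMonoid
  using (sum; sum-permute)

private variable
  n : ℕ

indicator : {P : Set} → Dec P → ℕ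
indicator (yes _) = 1
indicator (no _)  = 0

indicator-mono : {P Q : Set} (P? : Dec P) (Q? : Dec Q) → (P → Q) → indicator P? ≤ indicator Q?
indicator-mono (no _)  _      _ = z≤n
indicator-mono (yes _) (yes _) _ = ℕ.≤-refl
indicator-mono (yes p) (no ¬q) f = ⊥-elim (¬q (f p))

indicator-< : {P Q : Set} (P? : Dec P) (Q? : Dec Q) → ¬ P → Q → indicator P? <ℕ indicator Q?
indicator-< (yes p) _       ¬p _ = ⊥-elim (¬p p)
indicator-< (no _)  (yes _) _  _ = ℕ.≤-refl
indicator-< (no _)  (no ¬q) _  q = ⊥-elim (¬q q)

sum-mono : (f g : Fin n → ℕ) → (∀ i → f i ≤ g i) → sum f ≤ sum g
sum-mono {zero}  f g f≤g = z≤n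
sum-mono {suc n} f g f≤g =
  ℕ.+-mono-≤ (f≤g Fin.zero) (sum-mono (f ∘ Fin.suc) (g ∘ Fin.suc) (f≤g ∘ Fin.suc))

sum-< : (f g : Fin n → ℕ) → (∀ i → f i ≤ g i) → ∀ i₀ → f i₀ <ℕ g i₀ → sum f <ℕ sum g
sum-< {suc n} f g f≤g Fin.zero    f<g =
  ℕ.+-mono-<-≤ f<g (sum-mono (f ∘ Fin.suc) (g ∘ Fin.suc) (f≤g ∘ Fin.suc))
sum-< {suc n} f g f≤g (Fin.suc i) f<g =
  ℕ.+-mono-≤-< (f≤g Fin.zero) (sum-< (f ∘ Fin.suc) (g ∘ Fin.suc) (f≤g ∘ Fin.suc) i f<g)

module _ {P : Fin n → Set} (P? : ∀ x → Dec (P x)) where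

  count≡sum : count P? ≡ sum (indicator ∘ P?)
  count≡sum = go (λ x → x)
    where
    go : ∀ {m} (f : Fin m → Fin n) →
         length (filter P? (tabulate f)) ≡ sum (indicator ∘ P? ∘ f)
    go {zero}  f = refl
    go {suc m} f with P? (f Fin.zero)
    ... | yes _ = cong suc (go (f ∘ Fin.suc))
    ... | no _  = go (f ∘ Fin.suc)

  count-permute : (τ : Perm n) → count P? ≡ sum (λ p → indicator (P? (val τ p)))
  count-permute τ = trans count≡sum (sum-permute (indicator ∘ P?) τ)

module _ {P Q : Fin n → Set} (P? : ∀ x → Dec (P x)) (Q? : ∀ x → Dec (Q x)) where

  count-mono : (∀ x → P x → Q x) → count P? ≤ count Q?
  count-mono P⇒Q = subst₂ _≤_ (sym (count≡sum P?)) (sym (count≡sum Q?))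
    (sum-mono _ _ (λ x → indicator-mono (P? x) (Q? x) (P⇒Q x)))

  count-<-along : (τ ρ : Perm n) → (∀ p → P (val τ p) → Q (val ρ p)) →
    ∀ p₀ → ¬ P (val τ p₀) → Q (val ρ p₀) → count P? <ℕ count Q?
  count-<-along τ ρ P⇒Q p₀ ¬P Q₀ =
    subst₂ _<ℕ_ (sym (count-permute P? τ)) (sym (count-permute Q? ρ))
      (sum-< _ _ (λ p → indicator-mono (P? _) (Q? _) (P⇒Q p)) p₀ (indicator-< (P? _) (Q? _) ¬P Q₀))

count-cong : {P Q : Fin n → Set} (P? : ∀ x → Dec (P x)) (Q? : ∀ x → Dec (Q x)) →
  (∀ x → P x → Q x) → (∀ x → Q x → P x) → count P? ≡ count Q?
count-cong P? Q? P⇒Q Q⇒P = ℕ.≤-antisym (count-mono P? Q? P⇒Q) (count-mono Q? P? Q⇒P)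

module _ (τ : Perm n) where

  pos-val : ∀ p → pos τ (val τ p) ≡ p
  pos-val p = inverseˡ τ

  val-pos : ∀ v → val τ (pos τ v) ≡ v
  val-pos v = inverseʳ τ

val≗⇒pos≗ : (π σ : Perm n) → (∀ j → val π j ≡ val σ j) → ∀ v → pos π v ≡ pos σ v
val≗⇒pos≗ π σ π≗σ v = begin
  pos π v                  ≡⟨ cong (pos π) (sym (val-pos σ v)) ⟩
  pos π (val σ (pos σ v))  ≡⟨ cong (pos π) (sym (π≗σ (pos σ v))) ⟩
  pos π (val π (pos σ v))  ≡⟨ pos-val π (pos σ v) ⟩
  pos σ v                  ∎
  where open ≡-Reasoning

pos≗⇒val≗ : (π σ : Perm n) → (∀ v → pos π v ≡ pos σ v) → ∀ j → val π j ≡ val σ j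
pos≗⇒val≗ π σ = val≗⇒pos≗ (flip π) (flip σ)

record AgreeAbove (π σ : Perm n) (y : Fin n) : Set where
  constructor agreeAbove
  field pos≡ : ∀ {z} → y < z → pos π z ≡ pos σ z

open AgreeAbove

HasLargerToRight : Perm n → Fin n → Set
HasLargerToRight τ y = ∃ λ z → y < z × pos τ y < pos τ z

agreeAbove-sym : {π σ : Perm n} {y : Fin n} → AgreeAbove π σ y → AgreeAbove σ π y
agreeAbove-sym π≈σ = agreeAbove λ y<z → sym (pos≡ π≈σ y<z)

agreeAbove-val≡ : {π σ : Perm n} {y : Fin n} → AgreeAbove π σ y →
  ∀ p → y < val σ p → val π p ≡ val σ p
agreeAbove-val≡ {π = π} {σ} π≈σ p y<σp = begin
  val π p                  ≡⟨ cong (val π) (sym (pos-val σ p)) ⟩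
  val π (pos σ (val σ p))  ≡⟨ cong (val π) (sym (pos≡ π≈σ y<σp)) ⟩
  val π (pos π (val σ p))  ≡⟨ val-pos π (val σ p) ⟩
  val σ p                  ∎
  where open ≡-Reasoning

agreeAbove-val< : {π σ : Perm n} {y : Fin n} → AgreeAbove π σ y →
  ∀ p → ¬ y < val σ p → pos π y ≢ p → val π p < y
agreeAbove-val< {π = π} {σ} {y} π≈σ p y≮σp πy≢p with <-cmp (val π p) y
... | tri< πp<y _ _ = πp<y
... | tri≈ _ πp≡y _ = ⊥-elim (πy≢p (trans (cong (pos π) (sym πp≡y)) (pos-val π p)))
... | tri> _ _ y<πp =
  ⊥-elim (y≮σp (subst (y <_) (sym (agreeAbove-val≡ (agreeAbove-sym π≈σ) p y<πp)) y<πp))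

¬RLMax⇒hasLargerToRight : (τ : Perm n) (y : Fin n) → ¬ RLMax τ (pos τ y) → HasLargerToRight τ y
¬RLMax⇒hasLargerToRight τ y ¬max
  with any? (λ z → (y <? z) ×-dec (pos τ y <? pos τ z))
... | yes larger = larger
... | no ¬larger = ⊥-elim (¬max isMax)
  where
  isMax : RLMax τ (pos τ y)
  isMax i τy<i with <-cmp (val τ i) y
  ... | tri< τi<y _ _ = subst (val τ i <_) (sym (val-pos τ y)) τi<y
  ... | tri≈ _ τi≡y _ =
    ⊥-elim (<-irrefl (trans (cong (pos τ) (sym τi≡y)) (pos-val τ i)) τy<i)
  ... | tri> _ _ y<τi =
    ⊥-elim (¬larger (val τ i , y<τi , subst (pos τ y <_) (sym (pos-val τ i)) τy<i))

Separates : (Perm n → Fin n → ℕ) → Set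
Separates {n} st = (π σ : Perm n) (y : Fin n) → AgreeAbove π σ y → HasLargerToRight σ y →
  pos π y < pos σ y → st π y ≢ st σ y

ci-< : (π σ : Perm n) (y : Fin n) → AgreeAbove π σ y → HasLargerToRight σ y →
  pos π y < pos σ y → ci σ y <ℕ ci π y
ci-< π σ y π≈σ (z , y<z , σy<σz) πy<σy =
  count-<-along (IPlus? σ y) (IPlus? π y) σ π carried (pos σ y) not-in-σ in-π
  where
  carried : ∀ p → IPlus σ y (val σ p) → IPlus π y (val π p)
  carried p h rewrite pos-val σ p | pos-val π p with h
  ... | σy<p , σp<y , w , y<w , p<σw =
    let πy<p = <-trans πy<σy σy<p in
    πy<p , agreeAbove-val< π≈σ p (<-asym σp<y) (<⇒≢ πy<p) ,
    w , y<w , subst (p <_) (sym (pos≡ π≈σ y<w)) p<σw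
  not-in-σ : ¬ IPlus σ y (val σ (pos σ y))
  not-in-σ (_ , σσy<y , _) = <-irrefl (val-pos σ y) σσy<y
  in-π : IPlus π y (val π (pos σ y))
  in-π rewrite pos-val π (pos σ y) =
    πy<σy , agreeAbove-val< π≈σ (pos σ y) (<-irrefl (sym (val-pos σ y))) (<⇒≢ πy<σy) ,
    z , y<z , subst (pos σ y <_) (sym (pos≡ π≈σ y<z)) σy<σz

ca-< : (π σ : Perm n) (y : Fin n) → AgreeAbove π σ y → HasLargerToRight σ y →
  pos π y < pos σ y → ca π y <ℕ ca σ y
ca-< π σ y π≈σ σ-larger πy<σy =
  count-<-along (λ x → APlus? π x y) (λ x → APlus? σ x y) π σ carried (pos π y) not-in-π in-σ
  where
  σ≈π = agreeAbove-sym π≈σ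
  carried : ∀ p → APlus π (val π p) y → APlus σ (val σ p) y
  carried p h rewrite pos-val π p | pos-val σ p with h
  ... | p<πy , πp<y , _ =
    let p<σy = <-trans p<πy πy<σy in
    p<σy , agreeAbove-val< σ≈π p (<-asym πp<y) (<⇒≢ p<σy ∘ sym) , σ-larger
  not-in-π : ¬ APlus π (val π (pos π y)) y
  not-in-π (_ , ππy<y , _) = <-irrefl (val-pos π y) ππy<y
  in-σ : APlus σ (val σ (pos π y)) y
  in-σ rewrite pos-val σ (pos π y) =
    πy<σy , agreeAbove-val< σ≈π (pos π y) (<-irrefl (sym (val-pos π y))) (<⇒≢ πy<σy ∘ sym) ,
    σ-larger

ci-separates : Separates {n} ci
ci-separates π σ y π≈σ σ-larger πy<σy = ℕ.>⇒≢ (ci-< π σ y π≈σ σ-larger πy<σy)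

ca-separates : Separates {n} ca
ca-separates π σ y π≈σ σ-larger πy<σy = ℕ.<⇒≢ (ca-< π σ y π≈σ σ-larger πy<σy)

ci-cong : (π σ : Perm n) → (∀ v → pos π v ≡ pos σ v) → ∀ y → ci π y ≡ ci σ y
ci-cong {n} π σ π≗σ y =
  count-cong (IPlus? π y) (IPlus? σ y) (transport π σ π≗σ) (transport σ π (sym ∘ π≗σ))
  where
  transport : (τ ρ : Perm n) → (∀ v → pos τ v ≡ pos ρ v) → ∀ x → IPlus τ y x → IPlus ρ y x
  transport τ ρ τ≗ρ x (τy<τx , x<y , z , y<z , τx<τz) =
    subst₂ _<_ (τ≗ρ y) (τ≗ρ x) τy<τx , x<y , z , y<z , subst₂ _<_ (τ≗ρ x) (τ≗ρ z) τx<τz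

ca-cong : (π σ : Perm n) → (∀ v → pos π v ≡ pos σ v) → ∀ y → ca π y ≡ ca σ y
ca-cong {n} π σ π≗σ y =
  count-cong (λ x → APlus? π x y) (λ x → APlus? σ x y)
    (transport π σ π≗σ) (transport σ π (sym ∘ π≗σ))
  where
  transport : (τ ρ : Perm n) → (∀ v → pos τ v ≡ pos ρ v) → ∀ x → APlus τ x y → APlus ρ x y
  transport τ ρ τ≗ρ x (τx<τy , x<y , z , y<z , τy<τz) =
    subst₂ _<_ (τ≗ρ x) (τ≗ρ y) τx<τy , x<y , z , y<z , subst₂ _<_ (τ≗ρ y) (τ≗ρ z) τy<τz

NoRightShift : Perm n → Perm n → Set
NoRightShift {n} π σ = ∀ y → AgreeAbove π σ y → ¬ pos π y < pos σ y

pos≗-by-descent : (π σ : Perm n) → NoRightShift π σ → NoRightShift σ π → ∀ y → pos π y ≡ pos σ y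
pos≗-by-descent π σ π↛σ σ↛π = All.wfRec >-wellFounded 0ℓ (λ y → pos π y ≡ pos σ y) step
  where
  step : ∀ y → (∀ {z} → y < z → pos π z ≡ pos σ z) → pos π y ≡ pos σ y
  step y above with <-cmp (pos π y) (pos σ y)
  ... | tri< πy<σy _ _ = ⊥-elim (π↛σ y (agreeAbove above) πy<σy)
  ... | tri≈ _ πy≡σy _ = πy≡σy
  ... | tri> _ _ σy<πy = ⊥-elim (σ↛π y (agreeAbove-sym (agreeAbove above)) σy<πy)

module _ {M I : Subset n} where

  ∉M⇒hasLargerToRight : {τ : Perm n} → InS M I τ → ∀ y → y ∉ M → HasLargerToRight τ y
  ∉M⇒hasLargerToRight {τ} τ∈S y y∉M = ¬RLMax⇒hasLargerToRight τ y λ y-max →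
    y∉M (subst (_∈ M) (val-pos τ y) (InS.values⇐ τ∈S (pos τ y) y-max))

  ∈M⇒¬pos< : {π σ : Perm n} → InS M I π → InS M I σ → ∀ y → y ∈ M →
    AgreeAbove π σ y → ¬ pos π y < pos σ y
  ∈M⇒¬pos< {π} {σ} π∈S σ∈S y y∈M π≈σ πy<σy with InS.values⇒ π∈S y y∈M
  ... | j , j-max , πj≡y = <-irrefl y≡σa y<σa
    where
    a = pos π y
    a-max-π : RLMax π a
    a-max-π = subst (RLMax π) (trans (sym (pos-val π j)) (cong (pos π) πj≡y)) j-max
    a-max-σ : RLMax σ a
    a-max-σ = InS.positions⇒ σ∈S a (InS.positions⇐ π∈S a a-max-π)
    y<σa : y < val σ a
    y<σa = subst (_< val σ a) (val-pos σ y) (a-max-σ (pos σ y) πy<σy)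
    y≡σa : y ≡ val σ a
    y≡σa = trans (sym (val-pos π y)) (agreeAbove-val≡ π≈σ a y<σa)

  noRightShift : (st : Perm n → Fin n → ℕ) → Separates st → {π σ : Perm n} →
    InS M I π → InS M I σ → (∀ y → y ∉ M → st π y ≡ st σ y) → NoRightShift π σ
  noRightShift st separates {π} {σ} π∈S σ∈S st≡ y π≈σ πy<σy with y ∈? M
  ... | yes y∈M = ∈M⇒¬pos< π∈S σ∈S y y∈M π≈σ πy<σy
  ... | no y∉M  = separates π σ y π≈σ (∉M⇒hasLargerToRight σ∈S y y∉M) πy<σy (st≡ y y∉M)

  separating-statistic-determines : (st : Perm n → Fin n → ℕ) → Separates st →
    {π σ : Perm n} → InS M I π → InS M I σ →
    (∀ y → y ∉ M → st π y ≡ st σ y) → ∀ j → val π j ≡ val σ j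
  separating-statistic-determines st separates {π} {σ} π∈S σ∈S st≡ =
    pos≗⇒val≗ π σ (pos≗-by-descent π σ
      (noRightShift st separates π∈S σ∈S st≡)
      (noRightShift st separates σ∈S π∈S (λ y y∉M → sym (st≡ y y∉M))))

-- The hypotheses on ∣ M ∣, ∣ I ∣ and fromℕ n are unused: the argument works for arbitrary M and I.
mainTheorem6 : (n : ℕ) (M I : Subset (suc n)) → ∣ M ∣ ≡ ∣ I ∣ →
    fromℕ n ∈ M → fromℕ n ∈ I →
    (π σ : Perm (suc n)) → InS M I π → InS M I σ →
    (((∀ y → y ∉ M → ci π y ≡ ci σ y) ⇔ (∀ j → π ⟨$⟩ʳ j ≡ σ ⟨$⟩ʳ j))
    × ((∀ y → y ∉ M → ca π y ≡ ca σ y) ⇔ (∀ j → π ⟨$⟩ʳ j ≡ σ ⟨$⟩ʳ j)))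
mainTheorem6 n M I _ _ _ π σ π∈S σ∈S =
    mk⇔ (separating-statistic-determines ci ci-separates π∈S σ∈S)
        (λ π≗σ y _ → ci-cong π σ (val≗⇒pos≗ π σ π≗σ) y)
  , mk⇔ (separating-statistic-determines ca ca-separates π∈S σ∈S)
        (λ π≗σ y _ → ca-cong π σ (val≗⇒pos≗ π σ π≗σ) y)
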